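{- Let $\hat\sigma=\{\hat R_1,\dots,\hat R_m\}$ be a spatial triangle database schema and $\mathcal D$ a consistent spatial triangle database over $\hat\sigma$. For every $\mathrm{FO}(\{\mathbf{PartOf}\})(\hat\sigma)$-query $\hat Q$ with $k$ free variables, $\hat Q(\mathcal D)$ is a consistent triangle relation, i.e. the set of $k$-tuples of triangles it defines is closed under independently permuting the three corners of each triangle of a tuple.
   Context: A (spatial) triangle is a triple $(a_1,a_2,a_3)\in(\mathbb{R}^2)^3$ (corners may coincide); its drawing is the convex hull of its corners. A set $C\subseteq((\mathbb{R}^2)^3)^k$ is consistent if it is closed under independently permuting the three corners of each of the $k$ triangles in a tuple. A spatial triangle relation of arity $k$ is a consistent such $C$ whose image in $\mathbb{R}^{6k}$ under the canonical coordinate bijection is semi-algebraic. A spatial triangle database over $\hat\sigma$ assigns to each $\hat R_i$ a relation of arity $ar(\hat R_i)$; it is consistent if all its relations are. $\mathrm{FO}(\{\mathbf{PartOf}\})(\hat\sigma)$ is first-order logic with variables ranging over triangles, atoms $t_1=t_2$ (equal drawings), $\mathbf{PartOf}(t_1,t_2)$ (drawing of $t_1\subseteq$ drawing of $t_2$) and $\hat R_i(t_1,\dots,t_{ar(\hat R_i)})$, closed under $\wedge,\vee,\neg,\exists$; a formula with free variables $t_1,\dots,t_k$ defines on $\mathcal D$ the set of $k$-tuples satisfying it. -}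

module Defs where

open import Level using (0ℓ)
open import Data.Nat using (ℕ; suc)
open import Data.Fin using (Fin)
open import Data.Fin.Permutation using (Permutation′; _⟨$⟩ʳ_)
open import Data.Product using (Σ; ∃; _×_; _,_)
open import Data.Sum using (_⊎_)
open import Data.Empty using (⊥)
open import Relation.Nullary using (¬_)
open import Relation.Binary.PropositionalEquality using (_≡_; _≢_)
open import Algebra.Structures using (IsCommutativeRing)
open import Function.Bundles using (_⇔_)
import Data.Vec.Functional as VF

-- The real numbers, axiomatised as a Dedekind-complete ordered field
-- (categorical: every model is isomorphic to ℝ).

record CompleteOrderedField : Set₁ where
  infixl 6 _+_
  infixl 7 _*_
  infix  4 _<_ _≤_
  field
    Carrier : Set
    _+_ _*_ : Carrier → Carrier → Carrier
    -_      : Carrier → Carrier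
    0# 1#   : Carrier
    isCommutativeRing : IsCommutativeRing _≡_ _+_ _*_ -_ 0# 1#
    0≢1     : 0# ≢ 1#
    inverse : ∀ x → x ≢ 0# → ∃ λ y → x * y ≡ 1#
    _<_     : Carrier → Carrier → Set
    <-irrefl : ∀ x → ¬ (x < x)
    <-trans  : ∀ {x y z} → x < y → y < z → x < z
    <-trichotomous : ∀ x y → x < y ⊎ x ≡ y ⊎ y < x
    +-mono-< : ∀ {x y} z → x < y → x + z < y + z
    *-pos    : ∀ {x y} → 0# < x → 0# < y → 0# < x * y
    complete : (P : Carrier → Set) → ∃ P →
               (∃ λ b → ∀ x → P x → (x < b ⊎ x ≡ b)) →
               ∃ λ s → (∀ x → P x → (x < s ⊎ x ≡ s)) ×
                       (∀ b → (∀ x → P x → (x < b ⊎ x ≡ b)) → (s < b ⊎ s ≡ b))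

  _≤_ : Carrier → Carrier → Set
  x ≤ y = x < y ⊎ x ≡ y

module Geometry (ℝ : CompleteOrderedField) where
  open CompleteOrderedField ℝ renaming (Carrier to R)

  Point : Set
  Point = R × R

  Triangle : Set
  Triangle = Fin 3 → Point

  InDrawing : Point → Triangle → Set
  InDrawing (px , py) t =
    Σ (Fin 3 → R) λ λs →
      (∀ j → 0# ≤ λs j) ×
      (λs Fin.zero + λs (Fin.suc Fin.zero) + λs (Fin.suc (Fin.suc Fin.zero)) ≡ 1#) ×
      (px ≡ wsum λs (λ j → Data.Product.proj₁ (t j))) ×
      (py ≡ wsum λs (λ j → Data.Product.proj₂ (t j)))
    where
    import Data.Fin as Fin
    import Data.Product
    wsum : (Fin 3 → R) → (Fin 3 → R) → R
    wsum l c = l Fin.zero * c Fin.zero + l (Fin.suc Fin.zero) * c (Fin.suc Fin.zero)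
             + l (Fin.suc (Fin.suc Fin.zero)) * c (Fin.suc (Fin.suc Fin.zero))

  SameDrawing : Triangle → Triangle → Set
  SameDrawing t₁ t₂ = ∀ p → InDrawing p t₁ ⇔ InDrawing p t₂

  PartOf : Triangle → Triangle → Set
  PartOf t₁ t₂ = ∀ p → InDrawing p t₁ → InDrawing p t₂

  permute : Triangle → Permutation′ 3 → Triangle
  permute t π j = t (π ⟨$⟩ʳ j)

  TriangleSet : ℕ → Set₁
  TriangleSet k = (Fin k → Triangle) → Set

  Consistent : ∀ {k} → TriangleSet k → Set
  Consistent {k} C = (ts : Fin k → Triangle) (πs : Fin k → Permutation′ 3) →
                     C ts → C (λ i → permute (ts i) (πs i))

  data Poly (V : Set) : Set where
    var  : V → Poly V
    con  : R → Poly V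
    _⊕_  : Poly V → Poly V → Poly V
    _⊗_  : Poly V → Poly V → Poly V
    ⊖_   : Poly V → Poly V

  evalP : ∀ {V} → (V → R) → Poly V → R
  evalP x (var v) = x v
  evalP x (con c) = c
  evalP x (p ⊕ q) = evalP x p + evalP x q
  evalP x (p ⊗ q) = evalP x p * evalP x q
  evalP x (⊖ p)   = - evalP x p

  data SAFormula (V : Set) : Set where
    isZero isPos : Poly V → SAFormula V
    _∧ₛ_ _∨ₛ_    : SAFormula V → SAFormula V → SAFormula V
    ¬ₛ_          : SAFormula V → SAFormula V

  ⟦_⟧ₛ : ∀ {V} → SAFormula V → (V → R) → Set
  ⟦ isZero p ⟧ₛ x = evalP x p ≡ 0#
  ⟦ isPos p ⟧ₛ x  = 0# < evalP x p
  ⟦ φ ∧ₛ ψ ⟧ₛ x  = ⟦ φ ⟧ₛ x × ⟦ ψ ⟧ₛ x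
  ⟦ φ ∨ₛ ψ ⟧ₛ x  = ⟦ φ ⟧ₛ x ⊎ ⟦ ψ ⟧ₛ x
  ⟦ ¬ₛ φ ⟧ₛ x    = ¬ ⟦ φ ⟧ₛ x

  SemiAlgebraic : ∀ {V : Set} → ((V → R) → Set) → Set
  SemiAlgebraic {V} S = Σ (SAFormula V) λ φ → ∀ x → S x ⇔ ⟦ φ ⟧ₛ x

  -- coordinates of a k-tuple: index (triangle i, corner j, coordinate c);
  -- this is ℝ^{6k} with a canonical indexing of the 6k coordinates
  Coord : ℕ → Set
  Coord k = Fin k × Fin 3 × Fin 2

  toTuple : ∀ {k} → (Coord k → R) → Fin k → Triangle
  toTuple x i j = x (i , j , Fin.zero) , x (i , j , Fin.suc Fin.zero)
    where import Data.Fin as Fin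

  image : ∀ {k} → TriangleSet k → (Coord k → R) → Set
  image C x = C (toTuple x)

  record SpatialTriangleRelation (k : ℕ) : Set₁ where
    field
      set           : TriangleSet k
      consistent    : Consistent set
      semiAlgebraic : SemiAlgebraic (image set)

  record Schema : Set where
    field
      m  : ℕ
      ar : Fin m → ℕ

  Database : Schema → Set₁
  Database σ = (i : Fin (Schema.m σ)) → SpatialTriangleRelation (Schema.ar σ i)

  ConsistentDB : ∀ {σ} → Database σ → Set
  ConsistentDB {σ} D = ∀ i → Consistent (SpatialTriangleRelation.set (D i))

  -- FO({PartOf})(σ̂): formulas with at most n free variables (de Bruijn)

  data FO (σ : Schema) : ℕ → Set where
    eqₜ     : ∀ {n} → Fin n → Fin n → FO σ n
    partOf  : ∀ {n} → Fin n → Fin n → FO σ n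
    rel     : ∀ {n} (i : Fin (Schema.m σ)) → (Fin (Schema.ar σ i) → Fin n) → FO σ n
    _∧ᶠ_ _∨ᶠ_ : ∀ {n} → FO σ n → FO σ n → FO σ n
    ¬ᶠ_     : ∀ {n} → FO σ n → FO σ n
    ∃ᶠ_     : ∀ {n} → FO σ (suc n) → FO σ n

  sat : ∀ {σ n} → Database σ → FO σ n → (Fin n → Triangle) → Set
  sat D (eqₜ a b) env    = SameDrawing (env a) (env b)
  sat D (partOf a b) env = PartOf (env a) (env b)
  sat D (rel i args) env = SpatialTriangleRelation.set (D i) (λ j → env (args j))
  sat D (φ ∧ᶠ ψ) env     = sat D φ env × sat D ψ env
  sat D (φ ∨ᶠ ψ) env     = sat D φ env ⊎ sat D ψ env
  sat D (¬ᶠ φ) env       = ¬ sat D φ env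
  sat D (∃ᶠ φ) env       = Σ Triangle λ t → sat D φ (t VF.∷ env)

  query : ∀ {σ k} → FO σ k → Database σ → TriangleSet k
  query Q D ts = sat D Q ts

-- Permuting the corners of a triangle preserves its drawing (permute the convex
-- weights with it) and, by consistency, membership in every database relation.
-- So satisfaction of any formula is invariant under permuting the corners of each
-- triangle in the environment, by induction on the formula; since this relation on
-- environments is symmetric, the negation case goes through as well.
module Submission where

open import Defs
open import Level using (0ℓ)
open import Data.Nat using (ℕ)
open import Data.Fin using (Fin; zero; suc)
open import Data.Fin.Permutation using (Permutation′; _⟨$⟩ʳ_; _⟨$⟩ˡ_; inverseʳ; flip; id)
open import Data.Product using (_,_; proj₁; proj₂)
open import Data.Sum using (inj₁; inj₂)
open import Function.Base using (_∘_)
open import Function.Bundles using (mk⇔; Equivalence)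
open import Relation.Binary.PropositionalEquality
open import Algebra.Bundles using (CommutativeMonoid)
open import Algebra.Structures using (IsCommutativeRing)
import Algebra.Properties.CommutativeMonoid.Sum as MonoidSum
import Data.Vec.Functional as VF

module _ (ℝ : CompleteOrderedField) where
  open CompleteOrderedField ℝ renaming (Carrier to R)
  open Geometry ℝ
  open IsCommutativeRing isCommutativeRing using (+-assoc; +-identityʳ; +-isCommutativeMonoid)

  +-commutativeMonoid : CommutativeMonoid 0ℓ 0ℓ
  +-commutativeMonoid = record { isCommutativeMonoid = +-isCommutativeMonoid }

  open MonoidSum +-commutativeMonoid using (sum; sum-permute)

  sum₃ : (Fin 3 → R) → R
  sum₃ f = f zero + f (suc zero) + f (suc (suc zero))

  sum₃≡sum : ∀ f → sum₃ f ≡ sum f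
  sum₃≡sum f = trans (+-assoc _ _ _) (cong (λ x → f zero + (f (suc zero) + x)) (sym (+-identityʳ _)))

  sum₃-permute : ∀ f (π : Permutation′ 3) → sum₃ (f ∘ (π ⟨$⟩ʳ_)) ≡ sum₃ f
  sum₃-permute f π = begin
    sum₃ (f ∘ (π ⟨$⟩ʳ_)) ≡⟨ sum₃≡sum (f ∘ (π ⟨$⟩ʳ_)) ⟩
    sum (f ∘ (π ⟨$⟩ʳ_))  ≡⟨ sum-permute f π ⟨
    sum f                ≡⟨ sum₃≡sum f ⟨
    sum₃ f               ∎
    where open ≡-Reasoning

  sum₃-cong : ∀ {f g} → f ≗ g → sum₃ f ≡ sum₃ g
  sum₃-cong f≗g = cong₂ _+_ (cong₂ _+_ (f≗g _) (f≗g _)) (f≗g _)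

  infix 4 _↭_
  record _↭_ (t t′ : Triangle) : Set where
    constructor _,_
    field
      permutation : Permutation′ 3
      reordered   : permute t permutation ≗ t′

  ↭-refl : ∀ {t} → t ↭ t
  ↭-refl = id , λ _ → refl

  ↭-sym : ∀ {t t′} → t ↭ t′ → t′ ↭ t
  ↭-sym {t} (π , eq) = flip π , λ j → trans (sym (eq (π ⟨$⟩ˡ j))) (cong t (inverseʳ π))

  weightedSum-permute : ∀ (π : Permutation′ 3) (l c c′ : Fin 3 → R) → c ∘ (π ⟨$⟩ʳ_) ≗ c′ →
                        sum₃ (λ j → l (π ⟨$⟩ʳ j) * c′ j) ≡ sum₃ (λ j → l j * c j)
  weightedSum-permute π l c c′ eq =
    trans (sum₃-cong (λ j → cong (l (π ⟨$⟩ʳ j) *_) (sym (eq j)))) (sum₃-permute (λ j → l j * c j) π)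

  InDrawing-↭ : ∀ {p t t′} → t ↭ t′ → InDrawing p t → InDrawing p t′
  InDrawing-↭ {t = t} {t′} (π , eq) (l , l≥0 , ∑l≡1 , px≡ , py≡) =
    l ∘ (π ⟨$⟩ʳ_) , l≥0 ∘ (π ⟨$⟩ʳ_) , trans (sum₃-permute l π) ∑l≡1 ,
    trans px≡ (sym (weightedSum-permute π l (proj₁ ∘ t) (proj₁ ∘ t′) (cong proj₁ ∘ eq))) ,
    trans py≡ (sym (weightedSum-permute π l (proj₂ ∘ t) (proj₂ ∘ t′) (cong proj₂ ∘ eq)))

  PartOf-↭ : ∀ {s s′ t t′} → s ↭ s′ → t ↭ t′ → PartOf s t → PartOf s′ t′
  PartOf-↭ s↭s′ t↭t′ s⊆t p = InDrawing-↭ t↭t′ ∘ s⊆t p ∘ InDrawing-↭ (↭-sym s↭s′)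

  SameDrawing-↭ : ∀ {s s′ t t′} → s ↭ s′ → t ↭ t′ → SameDrawing s t → SameDrawing s′ t′
  SameDrawing-↭ s↭s′ t↭t′ s≡t p =
    mk⇔ (PartOf-↭ s↭s′ t↭t′ (λ q → Equivalence.to (s≡t q)) p)
        (PartOf-↭ t↭t′ s↭s′ (λ q → Equivalence.from (s≡t q)) p)

  evalP-cong : ∀ {V} {x y : V → R} → x ≗ y → (p : Poly V) → evalP x p ≡ evalP y p
  evalP-cong x≗y (var v) = x≗y v
  evalP-cong x≗y (con c) = refl
  evalP-cong x≗y (p ⊕ q) = cong₂ _+_ (evalP-cong x≗y p) (evalP-cong x≗y q)
  evalP-cong x≗y (p ⊗ q) = cong₂ _*_ (evalP-cong x≗y p) (evalP-cong x≗y q)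
  evalP-cong x≗y (⊖ p)   = cong -_ (evalP-cong x≗y p)

  ⟦⟧ₛ-resp-≗ : ∀ {V} {x y : V → R} → x ≗ y → (φ : SAFormula V) → ⟦ φ ⟧ₛ x → ⟦ φ ⟧ₛ y
  ⟦⟧ₛ-resp-≗ x≗y (isZero p) px≡0   = trans (sym (evalP-cong x≗y p)) px≡0
  ⟦⟧ₛ-resp-≗ x≗y (isPos p) px>0    = subst (0# <_) (evalP-cong x≗y p) px>0
  ⟦⟧ₛ-resp-≗ x≗y (φ ∧ₛ ψ) (a , b)  = ⟦⟧ₛ-resp-≗ x≗y φ a , ⟦⟧ₛ-resp-≗ x≗y ψ b
  ⟦⟧ₛ-resp-≗ x≗y (φ ∨ₛ ψ) (inj₁ a) = inj₁ (⟦⟧ₛ-resp-≗ x≗y φ a)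
  ⟦⟧ₛ-resp-≗ x≗y (φ ∨ₛ ψ) (inj₂ b) = inj₂ (⟦⟧ₛ-resp-≗ x≗y ψ b)
  ⟦⟧ₛ-resp-≗ x≗y (¬ₛ φ) ¬a a       = ¬a (⟦⟧ₛ-resp-≗ (sym ∘ x≗y) φ a)

  SemiAlgebraic-resp-≗ : ∀ {V} {S : (V → R) → Set} → SemiAlgebraic S →
                         ∀ {x y} → x ≗ y → S x → S y
  SemiAlgebraic-resp-≗ (φ , S⇔φ) {x} {y} x≗y Sx =
    Equivalence.from (S⇔φ y) (⟦⟧ₛ-resp-≗ x≗y φ (Equivalence.to (S⇔φ x) Sx))

  coordinates : ∀ {k} → (Fin k → Triangle) → Coord k → R
  coordinates ts (i , j , zero)     = proj₁ (ts i j)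
  coordinates ts (i , j , suc zero) = proj₂ (ts i j)

  -- Without function extensionality, pointwise equal tuples need not lie in the same
  -- relation; semi-algebraicity is what makes a relation respect _≗_.
  relation-resp-≗ : ∀ {k} (C : SpatialTriangleRelation k) {ts ts′ : Fin k → Triangle} →
                    (∀ i → ts i ≗ ts′ i) →
                    SpatialTriangleRelation.set C ts → SpatialTriangleRelation.set C ts′
  relation-resp-≗ C {ts} {ts′} ts≗ts′ =
    SemiAlgebraic-resp-≗ (SpatialTriangleRelation.semiAlgebraic C) {coordinates ts} coordinates-≗
    where
    coordinates-≗ : coordinates ts ≗ coordinates ts′
    coordinates-≗ (i , j , zero)     = cong proj₁ (ts≗ts′ i j)
    coordinates-≗ (i , j , suc zero) = cong proj₂ (ts≗ts′ i j)

  module _ {σ} {D : Database σ} (consistent : ConsistentDB D) where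

    relation-↭ : ∀ r {ts ts′} → (∀ i → ts i ↭ ts′ i) →
                 SpatialTriangleRelation.set (D r) ts → SpatialTriangleRelation.set (D r) ts′
    relation-↭ r {ts} ts↭ts′ =
      relation-resp-≗ (D r) (_↭_.reordered ∘ ts↭ts′) ∘ consistent r ts (_↭_.permutation ∘ ts↭ts′)

    sat-↭ : ∀ {n} (Q : FO σ n) {env env′} → (∀ i → env i ↭ env′ i) → sat D Q env → sat D Q env′
    sat-↭ (eqₜ a b)    env↭ = SameDrawing-↭ (env↭ a) (env↭ b)
    sat-↭ (partOf a b) env↭ = PartOf-↭ (env↭ a) (env↭ b)
    sat-↭ (rel r args) env↭ = relation-↭ r (env↭ ∘ args)
    sat-↭ (φ ∧ᶠ ψ) env↭ (a , b)  = sat-↭ φ env↭ a , sat-↭ ψ env↭ b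
    sat-↭ (φ ∨ᶠ ψ) env↭ (inj₁ a) = inj₁ (sat-↭ φ env↭ a)
    sat-↭ (φ ∨ᶠ ψ) env↭ (inj₂ b) = inj₂ (sat-↭ ψ env↭ b)
    sat-↭ (¬ᶠ φ)   env↭ ¬a a     = ¬a (sat-↭ φ (↭-sym ∘ env↭) a)
    sat-↭ (∃ᶠ φ) {env} {env′} env↭ (t , a) = t , sat-↭ φ extended↭ a
      where
      extended↭ : ∀ i → (t VF.∷ env) i ↭ (t VF.∷ env′) i
      extended↭ zero    = ↭-refl
      extended↭ (suc i) = env↭ i

mainTheorem8 : (ℝ : CompleteOrderedField) → let open Geometry ℝ in
    (σ : Schema) (D : Database σ) → ConsistentDB D →
    (k : ℕ) (Q : FO σ k) → Consistent (query Q D)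
mainTheorem8 ℝ σ D consistent k Q ts πs =
  sat-↭ ℝ consistent Q (λ i → πs i , λ _ → refl)
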